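{- Let $n,k\geq 2$ be integers with $k\leq n^3$. Let $G_2:=\widehat{n^2\,F_{n^4}}$ and, for $c\geq 2$, let $G_{c+1}:=\widehat{(k-1)\,G_c}$. Then for every integer $c\geq 2$, every $c$-colouring of $G_c$ has clustering at least $k$.
   Context: All graphs are finite and simple. The fan $F_m$ is the graph obtained from the path on $m$ vertices by adding one new vertex adjacent to every vertex of the path. For a positive integer $m$ and a graph $G$, $\widehat{m\,G}$ denotes the graph obtained from $m$ pairwise disjoint copies of $G$ by adding one new vertex adjacent to all vertices of all copies. A colouring of a graph assigns a colour to each vertex (adjacent vertices may receive the same colour); a $c$-colouring uses at most $c$ colours. A monochromatic component is a connected component of the subgraph induced by the vertices of one colour. "Every colouring has clustering at least $k$" means every such colouring has a monochromatic component with at least $k$ vertices. -}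

module Defs where

open import Data.Nat using (ℕ; zero; suc; _*_; _^_; _∸_; _≡ᵇ_)
open import Data.Bool using (Bool; true; false; _∧_)
open import Data.Fin using (Fin; zero; suc; toℕ; remQuot)
open import Data.Fin.Properties using (_≟_)
open import Data.Product using (_×_; _,_; proj₁; proj₂; ∃; ∃-syntax)
open import Data.List using (List; length)
open import Data.List.Relation.Unary.All using (All)
open import Data.List.Relation.Unary.Unique.Propositional using (Unique)
open import Relation.Nullary.Decidable using (⌊_⌋)
open import Relation.Binary.PropositionalEquality using (_≡_)
open import Data.Nat using (_≤_)

record Graph : Set where
  field
    size : ℕ
    adj  : Fin size → Fin size → Bool
open Graph public

path-adj : ∀ {m} → Fin m → Fin m → Bool
path-adj i j = (suc (toℕ i) ≡ᵇ toℕ j) Data.Bool.∨ (suc (toℕ j) ≡ᵇ toℕ i)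

Fan : ℕ → Graph
Fan m = record { size = suc m ; adj = a }
  where
  a : Fin (suc m) → Fin (suc m) → Bool
  a zero    zero    = false
  a zero    (suc _) = true
  a (suc _) zero    = true
  a (suc i) (suc j) = path-adj i j

-- hat (m G): m disjoint copies of G plus an apex (vertex zero) adjacent to all.
-- Vertex suc x with remQuot x = (copy index , vertex of G).
hat : ℕ → Graph → Graph
hat m G = record { size = suc (m * size G) ; adj = a }
  where
  a : Fin (suc (m * size G)) → Fin (suc (m * size G)) → Bool
  a zero    zero    = false
  a zero    (suc _) = true
  a (suc _) zero    = true
  a (suc x) (suc y) with remQuot {m} (size G) x | remQuot {m} (size G) y
  ... | (p , u) | (q , v) = ⌊ p ≟ q ⌋ ∧ adj G u v

-- The sequence G_2, G_3, ... : Gseq n k i = G_{i+2}.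
Gseq : ℕ → ℕ → ℕ → Graph
Gseq n k zero    = hat (n ^ 2) (Fan (n ^ 4))
Gseq n k (suc i) = hat (k ∸ 1) (Gseq n k i)

Gc : ℕ → ℕ → ℕ → Graph
Gc n k c = Gseq n k (c ∸ 2)

Colouring : Graph → Set → Set
Colouring G A = Fin (size G) → A

data MonoReach {A : Set} (G : Graph) (f : Colouring G A) (u : Fin (size G))
     : Fin (size G) → Set where
  here : MonoReach G f u u
  step : ∀ {w x} → MonoReach G f u w → adj G w x ≡ true → f x ≡ f u
       → MonoReach G f u x

-- f has a monochromatic component with at least k vertices: some vertex v
-- whose monochromatic component contains k distinct vertices.
HasClusterAtLeast : {A : Set} (G : Graph) → Colouring G A → ℕ → Set
HasClusterAtLeast G f k =
  ∃[ v ] ∃[ S ] (Unique S × All (MonoReach G f v) S × k ≤ length S)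

-- In a c-colouring of  hat (k-1) G_c, either every copy of G_c
-- contains a vertex of the apex's colour, and those k-1 vertices together with
-- the apex form a monochromatic star on k vertices, or some copy avoids the
-- apex's colour and so is (c-1)-coloured, where induction applies.  For c = 2,
-- cut the path of each of the n^2 fans into n blocks of n^3 consecutive
-- vertices: either each of the n^3 blocks meets the apex's colour, giving a
-- star, or some block avoids it and is a monochromatic path on n^3 vertices.
module Submission where

open import Defs
open import Data.Bool using (true; _∨_; _∧_)
open import Data.Bool.Properties using (T-≡)
open import Data.Empty using (⊥-elim)
open import Data.Fin using (Fin; zero; suc; toℕ; inject₁; combine; remQuot; punchOut)
import Data.Fin.Properties as Finₚ
open import Data.List using (map; tabulate)
open import Data.List.Properties using (length-map; length-tabulate)
import Data.List.Relation.Unary.All as All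
import Data.List.Relation.Unary.All.Properties as Allₚ
import Data.List.Relation.Unary.Unique.Propositional.Properties as Uniqueₚ
open import Data.Nat using (ℕ; zero; suc; _+_; _*_; _^_; _≤_; s≤s; _≡ᵇ_)
import Data.Nat.Properties as ℕₚ
open import Data.Product using (∃-syntax; _×_; _,_; proj₁; proj₂)
open import Data.Sum using (_⊎_; inj₁; inj₂)
open import Function using (_∘_; Equivalence)
open import Relation.Nullary using (yes; no)
open import Relation.Nullary.Decidable using (⌊_⌋; isYes≗does; dec-true)
open import Relation.Binary.PropositionalEquality

module _ {A : Set} (G : Graph) (f : Colouring G A) where

  cluster-mono : ∀ {k l} → k ≤ l → HasClusterAtLeast G f l → HasClusterAtLeast G f k
  cluster-mono k≤l (v , S , S-unique , S-reached , l≤|S|) =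
    v , S , S-unique , S-reached , ℕₚ.≤-trans k≤l l≤|S|

  cluster-of-injection : ∀ {N} v (e : Fin N → Fin (size G)) →
    (∀ {i j} → e i ≡ e j → i ≡ j) → (∀ i → MonoReach G f v (e i)) →
    HasClusterAtLeast G f N
  cluster-of-injection v e e-injective e-reached =
    v , tabulate e , Uniqueₚ.tabulate⁺ e-injective , Allₚ.tabulate⁺ e-reached ,
    ℕₚ.≤-reflexive (sym (length-tabulate e))

  monoReach-path : ∀ {l} (P : Fin (suc l) → Fin (size G)) →
    (∀ i → adj G (P (inject₁ i)) (P (suc i)) ≡ true) →
    (∀ i → f (P i) ≡ f (P zero)) →
    ∀ i → MonoReach G f (P zero) (P i)
  monoReach-path P P-adj P-colour zero = here
  monoReach-path {suc l} P P-adj P-colour (suc i) =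
    step (monoReach-path (P ∘ inject₁) (P-adj ∘ inject₁) (P-colour ∘ inject₁) i)
         (P-adj i) (P-colour (suc i))

  cluster-of-path : ∀ {l} (P : Fin (suc l) → Fin (size G)) →
    (∀ {i j} → P i ≡ P j → i ≡ j) →
    (∀ i → adj G (P (inject₁ i)) (P (suc i)) ≡ true) →
    (∀ i → f (P i) ≡ f (P zero)) →
    HasClusterAtLeast G f (suc l)
  cluster-of-path P P-injective P-adj P-colour =
    cluster-of-injection (P zero) P P-injective (monoReach-path P P-adj P-colour)

module _ {A B : Set} (G : Graph) {f : Colouring G A} {g : Colouring G B}
         (f⇒g : ∀ x y → f x ≡ f y → g x ≡ g y) where

  monoReach-recolour : ∀ {u w} → MonoReach G f u w → MonoReach G g u w
  monoReach-recolour here               = here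
  monoReach-recolour (step r w~x fx≡fu) = step (monoReach-recolour r) w~x (f⇒g _ _ fx≡fu)

  cluster-recolour : ∀ {k} → HasClusterAtLeast G f k → HasClusterAtLeast G g k
  cluster-recolour (v , S , S-unique , S-reached , k≤|S|) =
    v , S , S-unique , All.map monoReach-recolour S-reached , k≤|S|

cluster-punchOut : ∀ G {c} (f : Colouring G (Fin (suc c))) {a} (a∉f : ∀ x → a ≢ f x) {k} →
  HasClusterAtLeast G (λ x → punchOut (a∉f x)) k → HasClusterAtLeast G f k
cluster-punchOut G f a∉f =
  cluster-recolour G (λ x y → Finₚ.punchOut-injective (a∉f x) (a∉f y))

two-colours-avoiding : {a x y : Fin 2} → a ≢ x → a ≢ y → x ≡ y
two-colours-avoiding a≢x a≢y = Finₚ.punchOut-injective a≢x a≢y (fin1 (punchOut a≢x) (punchOut a≢y))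
  where
  fin1 : (i j : Fin 1) → i ≡ j
  fin1 zero zero = refl

apex-cluster-or-avoiding-block : ∀ G {c} (f : Colouring G (Fin c)) (a : Fin (size G))
  {N s} (B : Fin N → Fin s → Fin (size G)) →
  (∀ {i j x y} → B i x ≡ B j y → i ≡ j) → (∀ i x → a ≢ B i x) →
  (∀ i x → adj G a (B i x) ≡ true) →
  HasClusterAtLeast G f (suc N) ⊎ ∃[ i ] (∀ x → f a ≢ f (B i x))
apex-cluster-or-avoiding-block G f a {N} B B-disjoint a∉B a~B
  with Finₚ.all? (λ i → Finₚ.any? (λ x → f (B i x) Finₚ.≟ f a))
... | yes meets = inj₁ (cluster-of-injection G f a star star-injective star-reached)
  where
  star : Fin (suc N) → Fin (size G)
  star zero    = a
  star (suc i) = B i (proj₁ (meets i))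

  star-injective : ∀ {i j} → star i ≡ star j → i ≡ j
  star-injective {zero}  {zero}  _  = refl
  star-injective {zero}  {suc j} eq = ⊥-elim (a∉B j _ eq)
  star-injective {suc i} {zero}  eq = ⊥-elim (a∉B i _ (sym eq))
  star-injective {suc i} {suc j} eq = cong suc (B-disjoint eq)

  star-reached : ∀ i → MonoReach G f a (star i)
  star-reached zero    = here
  star-reached (suc i) = step here (a~B i _) (proj₂ (meets i))
... | no ¬all-meet with Finₚ.¬∀⟶∃¬ N _ (λ i → Finₚ.any? (λ x → f (B i x) Finₚ.≟ f a)) ¬all-meet
...   | i , misses = inj₂ (i , λ x fa≡fBix → misses (x , sym fa≡fBix))

module _ (m : ℕ) (G : Graph) where

  copy : Fin m → Fin (size G) → Fin (size (hat m G))
  copy p u = suc (combine p u)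

  copy-injective : ∀ {p q u v} → copy p u ≡ copy q v → p ≡ q × u ≡ v
  copy-injective eq = Finₚ.combine-injective _ _ _ _ (Finₚ.suc-injective eq)

  adj-copy : ∀ p u v → adj (hat m G) (copy p u) (copy p v) ≡ adj G u v
  adj-copy p u v = begin
    adj (hat m G) (copy p u) (copy p v)
      ≡⟨ cong₂ (λ x y → ⌊ proj₁ x Finₚ.≟ proj₁ y ⌋ ∧ adj G (proj₂ x) (proj₂ y))
               (Finₚ.remQuot-combine p u) (Finₚ.remQuot-combine p v) ⟩
    ⌊ p Finₚ.≟ p ⌋ ∧ adj G u v
      ≡⟨ cong (_∧ adj G u v) (trans (isYes≗does (p Finₚ.≟ p)) (dec-true (p Finₚ.≟ p) refl)) ⟩
    adj G u v
      ∎
    where open ≡-Reasoning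

  monoReach-copy : ∀ {A} (f : Colouring (hat m G) A) p {u w} →
    MonoReach G (f ∘ copy p) u w → MonoReach (hat m G) f (copy p u) (copy p w)
  monoReach-copy f p here                = here
  monoReach-copy f p (step r w~x fx≡fu) =
    step (monoReach-copy f p r) (trans (adj-copy p _ _) w~x) fx≡fu

  cluster-copy : ∀ {A} (f : Colouring (hat m G) A) p {k} →
    HasClusterAtLeast G (f ∘ copy p) k → HasClusterAtLeast (hat m G) f k
  cluster-copy f p {k} (v , S , S-unique , S-reached , k≤|S|) =
    copy p v , map (copy p) S ,
    Uniqueₚ.map⁺ (proj₂ ∘ copy-injective) S-unique ,
    Allₚ.map⁺ (All.map (monoReach-copy f p) S-reached) ,
    subst (k ≤_) (sym (length-map (copy p) S)) k≤|S|

cluster-hat : ∀ {c} k G → (∀ (g : Colouring G (Fin c)) → HasClusterAtLeast G g (suc k)) →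
  (f : Colouring (hat k G) (Fin (suc c))) → HasClusterAtLeast (hat k G) f (suc k)
cluster-hat k G cluster-G f
  with apex-cluster-or-avoiding-block (hat k G) f zero (copy k G)
         (proj₁ ∘ copy-injective k G) (λ _ _ ()) (λ _ _ → refl)
... | inj₁ star                = star
... | inj₂ (p , p-avoids-apex) =
  cluster-copy k G f p (cluster-punchOut G (f ∘ copy k G p) p-avoids-apex (cluster-G _))

path-adj-succ : ∀ {n} (u v : Fin n) → suc (toℕ u) ≡ toℕ v → path-adj u v ≡ true
path-adj-succ u v 1+u≡v =
  cong (_∨ (suc (toℕ v) ≡ᵇ toℕ u)) (Equivalence.to T-≡ (ℕₚ.≡⇒≡ᵇ (suc (toℕ u)) (toℕ v) 1+u≡v))

toℕ-combine-inject₁-suc : ∀ {a b} (j : Fin a) (o : Fin b) →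
  suc (toℕ (combine j (inject₁ o))) ≡ toℕ (combine j (suc o))
toℕ-combine-inject₁-suc {b = b} j o = begin
  suc (toℕ (combine j (inject₁ o)))    ≡⟨ cong suc (Finₚ.toℕ-combine j (inject₁ o)) ⟩
  suc (suc b * toℕ j + toℕ (inject₁ o)) ≡⟨ cong (λ t → suc (suc b * toℕ j + t)) (Finₚ.toℕ-inject₁ o) ⟩
  suc (suc b * toℕ j + toℕ o)           ≡⟨ ℕₚ.+-suc (suc b * toℕ j) (toℕ o) ⟨
  suc b * toℕ j + suc (toℕ o)           ≡⟨ Finₚ.toℕ-combine j (suc o) ⟨
  toℕ (combine j (suc o))               ∎
  where open ≡-Reasoning

-- The paths of the m fans of  hat m (Fan (b * (l + 1)))  split into m * b
-- blocks of l + 1 consecutive vertices.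
module FanBlocks (m b l : ℕ) where

  H : Graph
  H = hat m (Fan (b * suc l))

  fan : Fin (m * b) → Fin m
  fan i = proj₁ (remQuot {m} b i)

  part : Fin (m * b) → Fin b
  part i = proj₂ (remQuot {m} b i)

  block : Fin (m * b) → Fin (suc l) → Fin (size H)
  block i o = copy m (Fan (b * suc l)) (fan i) (suc (combine (part i) o))

  block-disjoint : ∀ {i j x y} → block i x ≡ block j y → i ≡ j
  block-disjoint {i} {j} {x} {y} eq = begin
    i                        ≡⟨ Finₚ.combine-remQuot {m} b i ⟨
    combine (fan i) (part i) ≡⟨ cong₂ combine fan-i≡fan-j part-i≡part-j ⟩
    combine (fan j) (part j) ≡⟨ Finₚ.combine-remQuot {m} b j ⟩
    j                        ∎
    where
    open ≡-Reasoning
    fan-i≡fan-j : fan i ≡ fan j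
    fan-i≡fan-j = proj₁ (copy-injective m (Fan (b * suc l)) eq)
    part-i≡part-j : part i ≡ part j
    part-i≡part-j = proj₁ (Finₚ.combine-injective (part i) x (part j) y
      (Finₚ.suc-injective (proj₂ (copy-injective m (Fan (b * suc l)) eq))))

  block-injective : ∀ i {x y} → block i x ≡ block i y → x ≡ y
  block-injective i {x} {y} eq = proj₂ (Finₚ.combine-injective (part i) x (part i) y
    (Finₚ.suc-injective (proj₂ (copy-injective m (Fan (b * suc l)) eq))))

  block-adj : ∀ i o → adj H (block i (inject₁ o)) (block i (suc o)) ≡ true
  block-adj i o = trans (adj-copy m (Fan (b * suc l)) (fan i) (suc u) (suc v))
                        (path-adj-succ u v (toℕ-combine-inject₁-suc (part i) o))
    where
    u v : Fin (b * suc l)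
    u = combine (part i) (inject₁ o)
    v = combine (part i) (suc o)

  cluster : ∀ {k} → k ≤ m * b → k ≤ suc l → (f : Colouring H (Fin 2)) → HasClusterAtLeast H f k
  cluster k≤mb k≤1+l f
    with apex-cluster-or-avoiding-block H f zero block block-disjoint (λ _ _ ()) (λ _ _ → refl)
  ... | inj₁ star                 = cluster-mono H f (ℕₚ.m≤n⇒m≤1+n k≤mb) star
  ... | inj₂ (i , i-avoids-apex) =
    cluster-mono H f k≤1+l
      (cluster-of-path H f (block i) (block-injective i) (block-adj i)
        (λ o → two-colours-avoiding (i-avoids-apex o) (i-avoids-apex zero)))

cluster-Gseq : ∀ n k → suc k ≤ n ^ 3 → ∀ i (f : Colouring (Gseq n (suc k) i) (Fin (2 + i))) →
  HasClusterAtLeast (Gseq n (suc k) i) f (suc k)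
cluster-Gseq zero    k ()
cluster-Gseq (suc n) k 1+k≤n³ zero =
  FanBlocks.cluster (suc n ^ 2) (suc n) _ (subst (suc k ≤_) (ℕₚ.*-comm (suc n) (suc n ^ 2)) 1+k≤n³) 1+k≤n³
cluster-Gseq n k 1+k≤n³ (suc i) =
  cluster-hat k (Gseq n (suc k) i) (cluster-Gseq n k 1+k≤n³ i)

lemma27 : (n k : ℕ) → 2 ≤ n → 2 ≤ k → k ≤ n ^ 3 →
    (c : ℕ) → 2 ≤ c → (f : Colouring (Gc n k c) (Fin c)) →
    HasClusterAtLeast (Gc n k c) f k
lemma27 n (suc k) _ _ 1+k≤n³ (suc (suc c)) (s≤s (s≤s _)) = cluster-Gseq n k 1+k≤n³ c
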